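{- Let $(x_i)_{i\in\mathbb{N}}$ be a sequence of rationals in $[0,1]$ and let $T(s,k)$ for $s\in\mathbb{B}^\ast$, $k\in\mathbb{N}$ be the predicate $|s|<k\wedge\exists i\,(|s|<i\le k\wedge x_i\in I_s)$. Then (using countable choice) there exists $\beta\colon\mathbb{N}\to\mathbb{N}$ such that for all $n$ and all $s\in\mathbb{B}^n$, $$\exists k\,T(s,k)\to T(s,\beta n).$$
   Context: $\mathbb{B}=\{0,1\}$, $\mathbb{B}^n$ is the set of boolean sequences of length $n$, $\mathbb{B}^\ast$ of finite boolean sequences, $|s|$ the length. For $s\in\mathbb{B}^\ast$ with $|s|>0$, $I_s=\big[\sum_{i=0}^{|s|-1}s_i2^{ -(i+1)},\ \sum_{i=0}^{|s|-1}s_i2^{ -(i+1)}+2^{ -|s|}\big]$, and $I_{\langle\rangle}=[0,1]$. -}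

module Defs where

open import Data.Nat using (ℕ; zero; suc; _<_; _≤_)
open import Data.Bool using (Bool; true; false)
open import Data.List using (List; []; _∷_; length)
open import Data.Product using (_×_; ∃)
open import Data.Rational as Q using (ℚ; 0ℚ; 1ℚ; ½; _+_; _*_)

2^-_ : ℕ → ℚ
2^- zero = 1ℚ
2^- suc k = ½ * (2^- k)

bit : Bool → ℚ
bit true = 1ℚ
bit false = 0ℚ

leftFrom : ℕ → List Bool → ℚ
leftFrom i [] = 0ℚ
leftFrom i (b ∷ s) = bit b * (2^- suc i) + leftFrom (suc i) s

-- left endpoint of I_s : Σ_{i < |s|} s_i 2^{-(i+1)}
left : List Bool → ℚ
left s = leftFrom 0 s

_∈I_ : ℚ → List Bool → Set
q ∈I s = left s Q.≤ q × q Q.≤ left s + 2^- length s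

T : (ℕ → ℚ) → List Bool → ℕ → Set
T x s k = length s < k × ∃ λ i → (length s < i × i ≤ k) × x i ∈I s

-- By excluded middle, each s has a k_s with T(s,k_s) whenever some T(s,k) holds
-- (k_s = 0 otherwise). Since T(s,k) is monotone in k and 𝔹ⁿ is finite,
-- β n = max over s ∈ 𝔹ⁿ of k_s works.
module Submission where

open import Defs
open import Level using (0ℓ)
open import Axiom.ExcludedMiddle using (ExcludedMiddle)
open import Data.Nat using (ℕ; zero; suc; _⊔_)
open import Data.Nat.Properties using (≤-trans; ≤-refl; m≤m⊔n; m≤n⊔m; <-≤-trans)
open import Data.Bool using (Bool; true; false)
open import Data.Vec using (Vec; toList; []; _∷_)
open import Data.Product using (Σ; ∃; _×_; _,_; proj₁; proj₂)
open import Data.Rational using (ℚ; 0ℚ; 1ℚ; _≤_)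
open import Relation.Nullary using (yes; no)
open import Data.Empty using (⊥-elim)
import Data.Nat as ℕ

em⇒witness : ∀ {ℓ} {A : Set ℓ} → ExcludedMiddle ℓ → A → (P : A → Set ℓ) →
             Σ A λ a → ∃ P → P a
em⇒witness em default P with em {∃ P}
... | yes (a , pa) = a , λ _ → pa
... | no ¬∃P       = default , λ ∃P → ⊥-elim (¬∃P ∃P)

maximumOver : (n : ℕ) → (Vec Bool n → ℕ) → ℕ
maximumOver zero    f = f []
maximumOver (suc n) f = maximumOver n (λ v → f (true ∷ v)) ⊔ maximumOver n (λ v → f (false ∷ v))

≤-maximumOver : ∀ n (f : Vec Bool n → ℕ) (v : Vec Bool n) → f v ℕ.≤ maximumOver n f
≤-maximumOver zero    f []          = ≤-refl
≤-maximumOver (suc n) f (true ∷ v)  = ≤-trans (≤-maximumOver n _ v) (m≤m⊔n _ _)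
≤-maximumOver (suc n) f (false ∷ v) = ≤-trans (≤-maximumOver n _ v) (m≤n⊔m _ _)

T-mono : ∀ x s {k k′} → k ℕ.≤ k′ → T x s k → T x s k′
T-mono x s k≤k′ (|s|<k , i , (|s|<i , i≤k) , xᵢ∈Iₛ) =
  <-≤-trans |s|<k k≤k′ , i , (|s|<i , ≤-trans i≤k k≤k′) , xᵢ∈Iₛ

lemma4p1 : ExcludedMiddle 0ℓ →
    (x : ℕ → ℚ) → (∀ i → 0ℚ ≤ x i × x i ≤ 1ℚ) →
    Σ (ℕ → ℕ) λ β → ∀ (n : ℕ) (s : Vec Bool n) →
    (∃ λ k → T x (toList s) k) → T x (toList s) (β n)
lemma4p1 em x _ = β , bounds
  where
  chosen : ∀ {n} (s : Vec Bool n) → Σ ℕ λ k → ∃ (T x (toList s)) → T x (toList s) k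
  chosen s = em⇒witness em 0 (T x (toList s))

  β : ℕ → ℕ
  β n = maximumOver n (λ s → proj₁ (chosen s))

  bounds : ∀ n (s : Vec Bool n) → ∃ (T x (toList s)) → T x (toList s) (β n)
  bounds n s ∃T = T-mono x (toList s) (≤-maximumOver n _ s) (proj₂ (chosen s) ∃T)
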